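{- Let $n\ge 3$ be an integer. Then $dyn_3(C_n\Box K_n)=n+1$.
   Context: $C_n$ is the cycle and $K_n$ the complete graph on $n$ vertices; $G\Box H$ is the Cartesian product (vertex set $V(G)\times V(H)$, $(u,v)\sim(u',v')$ iff $u=u'$ and $vv'\in E(H)$, or $v=v'$ and $uu'\in E(G)$). For constant threshold $t$, a set $D$ of vertices is a $t$-dynamic monopoly if starting from $D$ and repeatedly adding any vertex having at least $t$ neighbors in the current set eventually yields all vertices; $dyn_t(G)$ is the minimum size of a $t$-dynamic monopoly of $G$. -}

module Defs where

open import Data.Nat using (ℕ; zero; suc; _≤_)
open import Data.Fin using (Fin; toℕ)
open import Data.Product using (Σ; _×_; _,_)
open import Data.Sum using (_⊎_)
open import Data.List using (List; length)
open import Data.List.Membership.Propositional using (_∈_)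
open import Data.List.Relation.Unary.Unique.Propositional using (Unique)
open import Relation.Nullary using (¬_)
open import Relation.Binary.PropositionalEquality using (_≡_)
open import Function.Definitions using (Injective)

record Graph : Set₁ where
  field
    V   : Set
    Adj : V → V → Set
open Graph public

CycAdj : (n : ℕ) → Fin n → Fin n → Set
CycAdj n i j =
  (toℕ j ≡ suc (toℕ i)) ⊎ (toℕ i ≡ suc (toℕ j))
  ⊎ ((toℕ i ≡ 0) × (suc (toℕ j) ≡ n)) ⊎ ((toℕ j ≡ 0) × (suc (toℕ i) ≡ n))

C : ℕ → Graph
C n = record { V = Fin n ; Adj = CycAdj n }

K : ℕ → Graph
K n = record { V = Fin n ; Adj = λ i j → ¬ (i ≡ j) }

_□_ : Graph → Graph → Graph
G □ H = record
  { V   = V G × V H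
  ; Adj = λ { (u , v) (u' , v') →
             ((u ≡ u') × Adj H v v') ⊎ ((v ≡ v') × Adj G u u') } }

-- Vertices eventually activated from seed set D under threshold t:
-- a vertex is activated if it is in D, or it has t distinct activated neighbours.
data Activated (G : Graph) (t : ℕ) (D : List (V G)) : V G → Set where
  seed : ∀ {v} → v ∈ D → Activated G t D v
  grow : ∀ {v} (f : Fin t → V G) → Injective _≡_ _≡_ f →
         (∀ i → Adj G (f i) v) → (∀ i → Activated G t D (f i)) →
         Activated G t D v

IsDynMono : (G : Graph) → ℕ → List (V G) → Set
IsDynMono G t D = ∀ v → Activated G t D v

-- dyn_t(G) = m : some t-dynamic monopoly (a duplicate-free list, i.e. a set) has
-- size m, and every t-dynamic monopoly has size ≥ m.
DynEq : (G : Graph) → ℕ → ℕ → Set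
DynEq G t m =
  (Σ (List (V G)) λ D → Unique D × length D ≡ m × IsDynMono G t D)
  × (∀ D → Unique D → IsDynMono G t D → m ≤ length D)

module Submission where

-- Upper bound: seed the diagonal together with (0 , 1). A fibre {i} × Kₙ containing the active
-- (i , i) and (i , i+1) fills up: first (i , i-1) (its third neighbour (i-1 , i-1) is a seed),
-- then every (i , j). Once fibre i-1 is full, (i , i+1) sees (i-1 , i+1), (i , i), (i+1 , i+1).
-- So the fibres 0, 1, …, n-1 fill up in turn.
--
-- Lower bound: a vertex has only two neighbours outside its fibre, so a fibre without seeds
-- stays inactive; hence n seeds must be one seed (i , s i) per fibre. The hull
-- {(i , b) | b = s i, or s (i-1) = b = s (i+1)} contains them and is closed, since every vertex
-- outside it has at most two neighbours inside. A column b ∉ {s 0, s (n-1)} gives an inactive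
-- vertex (0 , b).

open import Defs
open import Data.Nat using (ℕ; suc; _+_; _≤_; _<_; z≤n; s≤s)
import Data.Nat.Properties as ℕ
open import Data.Fin as Fin using (Fin; toℕ; fromℕ; inject₁; lower₁)
open import Data.Fin.Properties
  using (toℕ-injective; toℕ-fromℕ; toℕ-inject₁; toℕ-lower₁; toℕ<n; injective⇒≤)
open import Data.Fin.Induction using (<-weakInduction)
open import Data.Product using (∃; ∃₂; _×_; _,_; proj₁; proj₂)
open import Data.Product.Properties using (,-injectiveˡ; ,-injectiveʳ)
open import Data.Sum as Sum using (_⊎_; inj₁; inj₂)
open import Data.List using (List; _∷_; length; tabulate)
open import Data.List.Properties using (length-tabulate)
open import Data.List.Membership.Propositional using (_∈_; find; lose)
open import Data.List.Membership.Propositional.Properties using (∈-tabulate⁺)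
open import Data.List.Membership.Setoid.Properties using (index-injective)
open import Data.List.Relation.Unary.Any using (here; there; any?)
open import Data.List.Relation.Unary.AllPairs using (_∷_)
open import Data.List.Relation.Unary.Unique.Propositional using (Unique)
import Data.List.Relation.Unary.All.Properties as All
import Data.List.Relation.Unary.Unique.Propositional.Properties as Unique
open import Data.Empty using (⊥-elim)
open import Function using (_∘_)
open import Function.Definitions using (Injective)
open import Relation.Nullary using (¬_; Dec; yes; no; contradiction)
open import Relation.Nullary.Decidable using (_×-dec_; _⊎-dec_)
open import Relation.Binary.Definitions using (DecidableEquality)
open import Relation.Binary.PropositionalEquality

ClosedUnder : (G : Graph) (t : ℕ) → (V G → Set) → Set
ClosedUnder G t P = ∀ {v} (f : Fin t → V G) → Injective _≡_ _≡_ f →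
                    (∀ k → Adj G (f k) v) → (∀ k → P (f k)) → P v

Activated⊆closed : ∀ {G t D} {P : V G → Set} → (∀ {v} → v ∈ D → P v) →
                   ClosedUnder G t P → ∀ {v} → Activated G t D v → P v
Activated⊆closed D⊆P closed (seed v∈D)         = D⊆P v∈D
Activated⊆closed D⊆P closed (grow f inj adj act) =
  closed f inj adj (λ k → Activated⊆closed D⊆P closed (act k))

¬Fin3↣pair : ∀ {A : Set} (f : Fin 3 → A) → Injective _≡_ _≡_ f →
             (x y : A) → ¬ (∀ k → f k ≡ x ⊎ f k ≡ y)
¬Fin3↣pair f inj x y cover
  with cover Fin.zero | cover (Fin.suc Fin.zero) | cover (Fin.suc (Fin.suc Fin.zero))
... | inj₁ e₀ | inj₁ e₁ | _       = contradiction (inj (trans e₀ (sym e₁))) λ ()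
... | inj₂ e₀ | inj₂ e₁ | _       = contradiction (inj (trans e₀ (sym e₁))) λ ()
... | inj₁ e₀ | inj₂ _  | inj₁ e₂ = contradiction (inj (trans e₀ (sym e₂))) λ ()
... | inj₂ e₀ | inj₁ _  | inj₂ e₂ = contradiction (inj (trans e₀ (sym e₂))) λ ()
... | inj₁ _  | inj₂ e₁ | inj₂ e₂ = contradiction (inj (trans e₁ (sym e₂))) λ ()
... | inj₂ _  | inj₁ e₁ | inj₁ e₂ = contradiction (inj (trans e₁ (sym e₂))) λ ()

AtMostTwoNeighboursIn : (G : Graph) → (V G → Set) → V G → Set
AtMostTwoNeighboursIn G P v = ∃₂ λ x y → ∀ {u} → Adj G u v → P u → u ≡ x ⊎ u ≡ y

closed-if-sparse : ∀ {G} {P : V G → Set} →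
                   (∀ v → P v ⊎ AtMostTwoNeighboursIn G P v) → ClosedUnder G 3 P
closed-if-sparse sparse {v} f inj f~v Pf with sparse v
... | inj₁ Pv               = Pv
... | inj₂ (x , y , cover) = ⊥-elim (¬Fin3↣pair f inj x y (λ k → cover (f~v k) (Pf k)))

MaxDegree2 : Graph → Set
MaxDegree2 G = ∀ v → ∃₂ λ p q → ∀ {u} → Adj G u v → u ≡ p ⊎ u ≡ q

module _ {G H : Graph} (deg : MaxDegree2 G) (_≟_ : DecidableEquality (V G)) where

  unseeded-fibre-inactive : ∀ {D a b} → (∀ {u} → u ∈ D → proj₁ u ≢ a) →
                            ¬ Activated (G □ H) 3 D (a , b)
  unseeded-fibre-inactive {a = a} unseeded act =
    Activated⊆closed unseeded (closed-if-sparse sparse) act refl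
    where
    sparse : ∀ v → proj₁ v ≢ a ⊎ AtMostTwoNeighboursIn (G □ H) (λ u → proj₁ u ≢ a) v
    sparse (a' , b) with a' ≟ a | deg a
    ... | no a'≢a | _              = inj₁ a'≢a
    ... | yes refl | p , q , p⊎q  = inj₂ ((p , b) , (q , b) , cover)
      where
      cover : ∀ {u} → Adj (G □ H) u (a , b) → proj₁ u ≢ a → u ≡ (p , b) ⊎ u ≡ (q , b)
      cover {_ , _} (inj₁ (refl , _)) outside = contradiction refl outside
      cover {_ , _} (inj₂ (refl , u~a)) _     = Sum.map (cong (_, b)) (cong (_, b)) (p⊎q u~a)

  Activated⇒fibre-seeded : ∀ {D a b} → Activated (G □ H) 3 D (a , b) → ∃ λ b' → (a , b') ∈ D
  Activated⇒fibre-seeded {D} {a} act with any? (λ u → proj₁ u ≟ a) D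
  ... | no unseeded =
    ⊥-elim (unseeded-fibre-inactive (λ u∈D u∈fibre → unseeded (lose u∈D u∈fibre)) act)
  ... | yes seeded with find seeded
  ...   | (_ , b') , a,b'∈D , refl = b' , a,b'∈D

injective⇒≤length : ∀ {A : Set} {k} {xs : List A} (g : Fin k → A) → Injective _≡_ _≡_ g →
                    (∀ i → g i ∈ xs) → k ≤ length xs
injective⇒≤length g g-injective g∈xs =
  injective⇒≤ (λ eq → g-injective (index-injective (setoid _) (g∈xs _) (g∈xs _) eq))

seeds-on-graph : ∀ {n} {B : Set} → DecidableEquality B → {D : List (Fin n × B)} →
                 (s : Fin n → B) → (∀ i → (i , s i) ∈ D) → length D ≤ n →
                 ∀ {i b} → (i , b) ∈ D → b ≡ s i
seeds-on-graph {n} {B} _≟_ {D} s graph⊆D small {i} {b} i,b∈D with b ≟ s i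
... | yes b≡si = b≡si
... | no b≢si  = contradiction small (ℕ.<⇒≱ (injective⇒≤length g g-injective g∈D))
  where
  g : Fin (suc n) → Fin n × B
  g Fin.zero    = i , b
  g (Fin.suc k) = k , s k

  g-injective : Injective _≡_ _≡_ g
  g-injective {Fin.zero}  {Fin.zero}  _  = refl
  g-injective {Fin.zero}  {Fin.suc _} refl = contradiction refl b≢si
  g-injective {Fin.suc _} {Fin.zero}  refl = contradiction refl b≢si
  g-injective {Fin.suc _} {Fin.suc _} eq = cong Fin.suc (,-injectiveˡ eq)

  g∈D : ∀ k → g k ∈ D
  g∈D Fin.zero    = i,b∈D
  g∈D (Fin.suc k) = graph⊆D k

prev : ∀ {n} → Fin n → Fin n
prev {suc k} Fin.zero = fromℕ k
prev (Fin.suc i) = inject₁ i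

next : ∀ {n} → Fin n → Fin n
next {suc k} i with k ℕ.≟ toℕ i
... | yes _   = Fin.zero
... | no k≢i = Fin.suc (lower₁ i k≢i)

CycAdj-sym : ∀ {n} {a b : Fin n} → CycAdj n a b → CycAdj n b a
CycAdj-sym (inj₁ e)               = inj₂ (inj₁ e)
CycAdj-sym (inj₂ (inj₁ e))        = inj₁ e
CycAdj-sym (inj₂ (inj₂ (inj₁ p))) = inj₂ (inj₂ (inj₂ p))
CycAdj-sym (inj₂ (inj₂ (inj₂ p))) = inj₂ (inj₂ (inj₁ p))

prev-adj : ∀ {n} (i : Fin n) → CycAdj n (prev i) i
prev-adj {suc k} Fin.zero = inj₂ (inj₂ (inj₂ (refl , cong suc (toℕ-fromℕ k))))
prev-adj (Fin.suc i)      = inj₁ (cong suc (sym (toℕ-inject₁ i)))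

next-adj : ∀ {n} (i : Fin n) → CycAdj n (next i) i
next-adj {suc k} i with k ℕ.≟ toℕ i
... | yes k≡i = inj₂ (inj₂ (inj₁ (refl , cong suc (sym k≡i))))
... | no k≢i  = inj₂ (inj₁ (cong suc (toℕ-lower₁ i k≢i)))

CycAdj⇒prev⊎next : ∀ {n} {a i : Fin n} → CycAdj n a i → a ≡ prev i ⊎ a ≡ next i
CycAdj⇒prev⊎next {suc k} {a} {i} a~i with k ℕ.≟ toℕ i
CycAdj⇒prev⊎next {i = Fin.suc i} (inj₁ 1+i≡1+a) | _ =
  inj₁ (toℕ-injective (trans (sym (ℕ.suc-injective 1+i≡1+a)) (sym (toℕ-inject₁ i))))
CycAdj⇒prev⊎next {suc k} {a} (inj₂ (inj₁ a≡1+i)) | yes k≡i =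
  contradiction (trans a≡1+i (cong suc (sym k≡i))) (ℕ.<⇒≢ (toℕ<n a))
CycAdj⇒prev⊎next {i = i} (inj₂ (inj₁ a≡1+i)) | no k≢i =
  inj₂ (toℕ-injective (trans a≡1+i (sym (cong suc (toℕ-lower₁ i k≢i)))))
CycAdj⇒prev⊎next (inj₂ (inj₂ (inj₁ (a≡0 , _)))) | yes _ =
  inj₂ (toℕ-injective a≡0)
CycAdj⇒prev⊎next (inj₂ (inj₂ (inj₁ (_ , 1+i≡n)))) | no k≢i =
  contradiction (sym (ℕ.suc-injective 1+i≡n)) k≢i
CycAdj⇒prev⊎next {suc k} {i = Fin.zero} (inj₂ (inj₂ (inj₂ (_ , 1+a≡n)))) | _ =
  inj₁ (toℕ-injective (trans (ℕ.suc-injective 1+a≡n) (sym (toℕ-fromℕ k))))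

CycAdj-irrefl : ∀ {k} {a : Fin (2 + k)} → ¬ CycAdj (2 + k) a a
CycAdj-irrefl (inj₁ e)                         = ℕ.1+n≢n (sym e)
CycAdj-irrefl (inj₂ (inj₁ e))                  = ℕ.1+n≢n (sym e)
CycAdj-irrefl (inj₂ (inj₂ (inj₁ (a≡0 , 1+a≡n)))) =
  ℕ.0≢1+n (ℕ.suc-injective (trans (cong suc (sym a≡0)) 1+a≡n))
CycAdj-irrefl (inj₂ (inj₂ (inj₂ (a≡0 , 1+a≡n)))) =
  ℕ.0≢1+n (ℕ.suc-injective (trans (cong suc (sym a≡0)) 1+a≡n))

prev≢next : ∀ {k} (i : Fin (3 + k)) → prev i ≢ next i
prev≢next Fin.zero ()  -- prev 0 and next 0 normalise to n-1 and 1
prev≢next {k} (Fin.suc i) with suc (suc k) ℕ.≟ suc (toℕ i)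
... | yes 2+k≡1+i = λ prev≡0 →
  ℕ.1+n≢0 (trans (ℕ.suc-injective 2+k≡1+i) (trans (sym (toℕ-inject₁ i)) (cong toℕ prev≡0)))
... | no 2+k≢1+i = λ prev≡next →
  ℕ.<⇒≢ (ℕ.m<n⇒m<1+n (ℕ.n<1+n _))
    (trans (sym (toℕ-inject₁ i))
           (trans (cong toℕ prev≡next) (cong suc (toℕ-lower₁ (Fin.suc i) 2+k≢1+i))))

next≢id : ∀ {k} (i : Fin (2 + k)) → next i ≢ i
next≢id i next≡i = CycAdj-irrefl (subst (λ a → CycAdj _ a i) next≡i (next-adj i))

prev≢id : ∀ {k} (i : Fin (2 + k)) → prev i ≢ i
prev≢id i prev≡i = CycAdj-irrefl (subst (λ a → CycAdj _ a i) prev≡i (prev-adj i))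

C-maxDegree2 : ∀ {n} → MaxDegree2 (C n)
C-maxDegree2 i = prev i , next i , CycAdj⇒prev⊎next

avoid-zero-and : ∀ {k} (y : Fin (3 + k)) → ∃ λ j → j ≢ Fin.zero × j ≢ y
avoid-zero-and y with y Fin.≟ Fin.suc Fin.zero
... | no y≢1   = Fin.suc Fin.zero , (λ ()) , ≢-sym y≢1
... | yes refl = Fin.suc (Fin.suc Fin.zero) , (λ ()) , (λ ())

avoid-two : ∀ {k} (x y : Fin (3 + k)) → ∃ λ j → j ≢ x × j ≢ y
avoid-two x y with x Fin.≟ Fin.zero | y Fin.≟ Fin.zero
... | no x≢0   | no y≢0   = Fin.zero , ≢-sym x≢0 , ≢-sym y≢0
... | yes refl | _        = avoid-zero-and y
... | no _     | yes refl with avoid-zero-and x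
...   | j , j≢0 , j≢x = j , j≢x , j≢0

module SeedHull {n m} (s : Fin n → Fin m) where

  Spread : Fin n → Fin m → Set
  Spread i b = s (prev i) ≡ b × s (next i) ≡ b

  Hull : Fin n × Fin m → Set
  Hull (i , b) = b ≡ s i ⊎ Spread i b

  Hull? : ∀ v → Dec (Hull v)
  Hull? (i , b) = (b Fin.≟ s i) ⊎-dec ((s (prev i) Fin.≟ b) ×-dec (s (next i) Fin.≟ b))

  data HullNeighbour (i : Fin n) (j : Fin m) : Fin n × Fin m → Set where
    own-seed    : HullNeighbour i j (i , s i)
    spread      : ∀ {b} → b ≢ j → Spread i b → HullNeighbour i j (i , b)
    prev-column : s (prev i) ≡ j → HullNeighbour i j (prev i , j)
    next-column : s (next i) ≡ j → HullNeighbour i j (next i , j)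

  classify : ∀ {i j u} → ¬ Hull (i , j) → Adj (C n □ K m) u (i , j) → Hull u →
             HullNeighbour i j u
  classify {u = _ , _} _ (inj₁ (refl , _))   (inj₁ refl) = own-seed
  classify {u = _ , _} _ (inj₁ (refl , b≢j)) (inj₂ b-spread) = spread b≢j b-spread
  classify {u = _ , _} _ (inj₂ (refl , a~i)) (inj₁ j≡sa) with CycAdj⇒prev⊎next a~i
  ... | inj₁ refl = prev-column (sym j≡sa)
  ... | inj₂ refl = next-column (sym j≡sa)
  classify {u = _ , _} ¬hull (inj₂ (refl , a~i)) (inj₂ (sprev≡j , snext≡j))
    with CycAdj⇒prev⊎next (CycAdj-sym a~i)
  ... | inj₁ refl = contradiction (inj₁ (sym sprev≡j)) ¬hull
  ... | inj₂ refl = contradiction (inj₁ (sym snext≡j)) ¬hull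

  hull-sparse : ∀ v → Hull v ⊎ AtMostTwoNeighboursIn (C n □ K m) Hull v
  hull-sparse (i , j) with Hull? (i , j) | s (prev i) Fin.≟ j | s (next i) Fin.≟ j
  ... | yes hull | _           | _           = inj₁ hull
  ... | no ¬hull | yes sprev≡j | yes snext≡j = contradiction (inj₂ (sprev≡j , snext≡j)) ¬hull
  ... | no ¬hull | yes sprev≡j | no snext≢j =
    inj₂ ((i , s i) , (prev i , j) , λ u~v hull → cover (classify ¬hull u~v hull))
    where
    cover : ∀ {u} → HullNeighbour i j u → u ≡ (i , s i) ⊎ u ≡ (prev i , j)
    cover own-seed                   = inj₁ refl
    cover (spread b≢j (sprev≡b , _)) = contradiction (trans (sym sprev≡b) sprev≡j) b≢j
    cover (prev-column _)            = inj₂ refl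
    cover (next-column snext≡j)      = contradiction snext≡j snext≢j
  ... | no ¬hull | no sprev≢j | yes snext≡j =
    inj₂ ((i , s i) , (next i , j) , λ u~v hull → cover (classify ¬hull u~v hull))
    where
    cover : ∀ {u} → HullNeighbour i j u → u ≡ (i , s i) ⊎ u ≡ (next i , j)
    cover own-seed                   = inj₁ refl
    cover (spread b≢j (_ , snext≡b)) = contradiction (trans (sym snext≡b) snext≡j) b≢j
    cover (prev-column sprev≡j)      = contradiction sprev≡j sprev≢j
    cover (next-column _)            = inj₂ refl
  ... | no ¬hull | no sprev≢j | no snext≢j =
    inj₂ ((i , s i) , (i , s (prev i)) , λ u~v hull → cover (classify ¬hull u~v hull))
    where
    cover : ∀ {u} → HullNeighbour i j u → u ≡ (i , s i) ⊎ u ≡ (i , s (prev i))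
    cover own-seed                 = inj₁ refl
    cover (spread _ (sprev≡b , _)) = inj₂ (cong (i ,_) (sym sprev≡b))
    cover (prev-column sprev≡j)    = contradiction sprev≡j sprev≢j
    cover (next-column snext≡j)    = contradiction snext≡j snext≢j

  off-hull-inactive : ∀ {D} → (∀ {i b} → (i , b) ∈ D → b ≡ s i) →
                      ∀ {v} → ¬ Hull v → ¬ Activated (C n □ K m) 3 D v
  off-hull-inactive D⊆graph ¬hull act =
    ¬hull (Activated⊆closed (λ { {_ , _} v∈D → inj₁ (D⊆graph v∈D) })
                            (closed-if-sparse hull-sparse) act)

monopoly-lower-bound : ∀ {n m} (D : List (Fin (suc n) × Fin (3 + m))) →
                       IsDynMono (C (suc n) □ K (3 + m)) 3 D → suc n < length D
monopoly-lower-bound {n} {m} D mono = ℕ.≰⇒> λ small →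
  off-hull-inactive (seeds-on-graph Fin._≟_ s (proj₂ ∘ fibre-seed) small)
                    (proj₂ off-hull) (mono (Fin.zero , proj₁ off-hull))
  where
  fibre-seed : ∀ i → ∃ λ b → (i , b) ∈ D
  fibre-seed i = Activated⇒fibre-seeded C-maxDegree2 Fin._≟_ (mono (i , Fin.zero))

  s : Fin (suc n) → Fin (3 + m)
  s = proj₁ ∘ fibre-seed

  open SeedHull s

  off-hull : ∃ λ j → ¬ Hull (Fin.zero , j)
  off-hull with avoid-two (s Fin.zero) (s (prev Fin.zero))
  ... | j , j≢s0 , j≢sprev =
    j , λ { (inj₁ j≡s0) → j≢s0 j≡s0 ; (inj₂ (sprev≡j , _)) → j≢sprev (sym sprev≡j) }

activate₃ : ∀ {G D v} {x y z : V G} → x ≢ y → x ≢ z → y ≢ z →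
            Adj G x v → Adj G y v → Adj G z v →
            Activated G 3 D x → Activated G 3 D y → Activated G 3 D z →
            Activated G 3 D v
activate₃ {G} {D} {v} {x} {y} {z} x≢y x≢z y≢z x~v y~v z~v x-act y-act z-act =
  grow f f-injective f~v f-act
  where
  f : Fin 3 → V G
  f Fin.zero                      = x
  f (Fin.suc Fin.zero)            = y
  f (Fin.suc (Fin.suc Fin.zero))  = z

  f-injective : Injective _≡_ _≡_ f
  f-injective {Fin.zero}                   {Fin.zero}                   _ = refl
  f-injective {Fin.zero}                   {Fin.suc Fin.zero}           e = contradiction e x≢y
  f-injective {Fin.zero}                   {Fin.suc (Fin.suc Fin.zero)} e = contradiction e x≢z
  f-injective {Fin.suc Fin.zero}           {Fin.zero}                   e = contradiction (sym e) x≢y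
  f-injective {Fin.suc Fin.zero}           {Fin.suc Fin.zero}           _ = refl
  f-injective {Fin.suc Fin.zero}           {Fin.suc (Fin.suc Fin.zero)} e = contradiction e y≢z
  f-injective {Fin.suc (Fin.suc Fin.zero)} {Fin.zero}                   e = contradiction (sym e) x≢z
  f-injective {Fin.suc (Fin.suc Fin.zero)} {Fin.suc Fin.zero}           e = contradiction (sym e) y≢z
  f-injective {Fin.suc (Fin.suc Fin.zero)} {Fin.suc (Fin.suc Fin.zero)} _ = refl

  f~v : ∀ k → Adj G (f k) v
  f~v Fin.zero                     = x~v
  f~v (Fin.suc Fin.zero)           = y~v
  f~v (Fin.suc (Fin.suc Fin.zero)) = z~v

  f-act : ∀ k → Activated G 3 D (f k)
  f-act Fin.zero                     = x-act
  f-act (Fin.suc Fin.zero)           = y-act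
  f-act (Fin.suc (Fin.suc Fin.zero)) = z-act

module _ {k : ℕ} where

  private
    G : Graph
    G = C (3 + k) □ K (3 + k)

  fibre-adj : ∀ {a b' b} → b' ≢ b → Adj G (a , b') (a , b)
  fibre-adj b'≢b = inj₁ (refl , b'≢b)

  column-adj : ∀ {a' a b} → CycAdj (3 + k) a' a → Adj G (a' , b) (a , b)
  column-adj a'~a = inj₂ (refl , a'~a)

  module _ {D : List (V G)} (diagonal-active : ∀ i → Activated G 3 D (i , i)) where

    FibreActive : Fin (3 + k) → Set
    FibreActive i = ∀ j → Activated G 3 D (i , j)

    fibre-active-if-next : ∀ i → Activated G 3 D (i , next i) → FibreActive i
    fibre-active-if-next i i,next = fibre
      where
      i,prev : Activated G 3 D (i , prev i)
      i,prev = activate₃ (≢-sym (next≢id i) ∘ ,-injectiveʳ) (≢-sym (prev≢id i) ∘ ,-injectiveˡ)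
                         (≢-sym (prev≢id i) ∘ ,-injectiveˡ)
                         (fibre-adj (≢-sym (prev≢id i))) (fibre-adj (≢-sym (prev≢next i)))
                         (column-adj (prev-adj i))
                         (diagonal-active i) i,next (diagonal-active (prev i))

      fibre : FibreActive i
      fibre j with j Fin.≟ i | j Fin.≟ next i | j Fin.≟ prev i
      ... | yes refl | _          | _          = diagonal-active i
      ... | no _     | yes refl   | _          = i,next
      ... | no _     | no _       | yes refl   = i,prev
      ... | no j≢i   | no j≢next  | no j≢prev  =
        activate₃ (≢-sym (next≢id i) ∘ ,-injectiveʳ) (≢-sym (prev≢id i) ∘ ,-injectiveʳ)
                  (≢-sym (prev≢next i) ∘ ,-injectiveʳ)
                  (fibre-adj (≢-sym j≢i)) (fibre-adj (≢-sym j≢next)) (fibre-adj (≢-sym j≢prev))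
                  (diagonal-active i) i,next i,prev

    next-active-if-prev-fibre : ∀ i → FibreActive (prev i) → Activated G 3 D (i , next i)
    next-active-if-prev-fibre i prev-fibre =
      activate₃ (prev≢id i ∘ ,-injectiveˡ) (prev≢next i ∘ ,-injectiveˡ)
                (≢-sym (next≢id i) ∘ ,-injectiveˡ)
                (column-adj (prev-adj i)) (fibre-adj (≢-sym (next≢id i))) (column-adj (next-adj i))
                (prev-fibre (next i)) (diagonal-active i) (diagonal-active (next i))

    all-active : Activated G 3 D (Fin.zero , next Fin.zero) → IsDynMono G 3 D
    all-active zero-next (i , j) =
      <-weakInduction FibreActive (fibre-active-if-next Fin.zero zero-next)
        (λ i' prev-full → fibre-active-if-next (Fin.suc i')
                                                (next-active-if-prev-fibre (Fin.suc i') prev-full))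
        i j

  diag : Fin (3 + k) → V G
  diag i = i , i

  diagonal-seeds : List (V G)
  diagonal-seeds = (Fin.zero , next Fin.zero) ∷ tabulate diag

  diagonal-seeds-unique : Unique diagonal-seeds
  diagonal-seeds-unique =
    All.tabulate⁺ {f = diag}
      (λ _ eq → next≢id Fin.zero (trans (,-injectiveʳ eq) (sym (,-injectiveˡ eq))))
    ∷ Unique.tabulate⁺ {f = diag} ,-injectiveˡ

  diagonal-seeds-length : length diagonal-seeds ≡ 4 + k
  diagonal-seeds-length = cong suc (length-tabulate diag)

  diagonal-seeds-monopoly : IsDynMono G 3 diagonal-seeds
  diagonal-seeds-monopoly =
    all-active (λ i → seed (there (∈-tabulate⁺ {f = diag} i))) (seed (here refl))

theorem7 : (n : ℕ) → 3 ≤ n → DynEq (C n □ K n) 3 (suc n)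
theorem7 (suc (suc (suc k))) (s≤s (s≤s (s≤s z≤n))) =
  (diagonal-seeds , diagonal-seeds-unique , diagonal-seeds-length , diagonal-seeds-monopoly) ,
  λ D _ monopoly → monopoly-lower-bound D monopoly
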